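{- Let $\kappa \geq 2$ and let $L_1,\ldots,L_s$ be distinct Latin squares of order $\kappa$ on the symbol set $\{1,\ldots,\kappa\}$ which are pairwise projective (i.e. $L_a$ and $L_b$ are projective for all $a\neq b$). Then $s \leq \kappa - 1$.
   Context: A Latin square of order $\kappa$ is a $\kappa\times\kappa$ array with entries in $\{1,\ldots,\kappa\}$ in which every symbol occurs exactly once in each row and exactly once in each column. Two Latin squares $L = [l_{ij}]$ and $L' = [l'_{ij}]$ of order $\kappa$ are called projective if all diagonal entries of both are equal to $1$, and for every row index $r$ of $L$ and every row index $s$ of $L'$ there is exactly one column index $c$ with $l_{rc} = l'_{sc}$. A set of pairwise projective Latin squares is called a set of mutually projective Latin squares (MPLS). -}

module Defs where

open import Data.Nat using (ℕ)
open import Data.Fin using (Fin; toℕ)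
open import Data.Product using (Σ; ∃; _×_; _,_)
open import Relation.Binary.PropositionalEquality using (_≡_; _≢_)

-- A κ×κ array with entries in Fin κ; symbol "1" of the paper is `zero`,
-- symbol i+1 of the paper is the Fin element i.
Array : ℕ → Set
Array κ = Fin κ → Fin κ → Fin κ

ExactlyOne : {n : ℕ} → (Fin n → Set) → Set
ExactlyOne {n} P = Σ (Fin n) λ c → P c × ((c' : Fin n) → P c' → c' ≡ c)

IsLatin : {κ : ℕ} → Array κ → Set
IsLatin {κ} L =
  ((r : Fin κ) (x : Fin κ) → ExactlyOne (λ c → L r c ≡ x)) ×
  ((c : Fin κ) (x : Fin κ) → ExactlyOne (λ r → L r c ≡ x))

UnitDiagonal : {κ : ℕ} → Array κ → Set
UnitDiagonal {κ} L = (i : Fin κ) → toℕ (L i i) ≡ 0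

Projective : {κ : ℕ} → Array κ → Array κ → Set
Projective {κ} L L' =
  UnitDiagonal L × UnitDiagonal L' ×
  ((r s : Fin κ) → ExactlyOne (λ c → L r c ≡ L' s c))

Distinct : {κ : ℕ} → Array κ → Array κ → Set
Distinct {κ} L L' = ∃ λ (r : Fin κ) → ∃ λ (c : Fin κ) → L r c ≢ L' r c

module Submission where

-- With fewer than two squares the bound is immediate.  With at
-- least two, every square Lₐ belongs to some projective pair and so has the
-- symbol 1 on its diagonal.  Look at the entry Lₐ(0,1) in the first row:
--   * it is never the symbol 1, because row 0 of the Latin square Lₐ already
--     holds 1 in column 0;
--   * a ↦ Lₐ(0,1) is injective, because for a ≠ b the rows 0 of Lₐ and L_b
--     agree in column 0 (both diagonals are 1), and projectivity allows them
--     to agree in only one column.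
-- So the squares inject into the κ - 1 symbols other than 1.

open import Defs
open import Data.Nat using (ℕ; suc; _≤_; _∸_; s≤s; z≤n)
open import Data.Fin using (Fin; zero; suc; toℕ; punchOut)
open import Data.Fin.Properties using (injective⇒≤; punchOut-injective; toℕ-injective; _≟_)
open import Data.Product using (_,_; proj₁)
open import Data.Empty using (⊥-elim)
open import Relation.Nullary using (yes; no)
open import Relation.Binary.PropositionalEquality using (_≡_; _≢_; refl; sym; trans)

exactlyOne-unique : ∀ {n} {P : Fin n → Set} → ExactlyOne P →
                    ∀ {c c'} → P c → P c' → c ≡ c'
exactlyOne-unique (_ , _ , only) p p' = trans (only _ p) (sym (only _ p'))

latin-row-injective : ∀ {κ} {L : Array κ} → IsLatin L →
                      ∀ r {c c'} → L r c ≡ L r c' → c ≡ c'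
latin-row-injective {L = L} (rows , _) r {c' = c'} eq =
  exactlyOne-unique (rows r (L r c')) eq refl

unitDiagonal-agree : ∀ {κ} {L L' : Array κ} → UnitDiagonal L → UnitDiagonal L' →
                     ∀ i → L i i ≡ L' i i
unitDiagonal-agree diag diag' i = toℕ-injective (trans (diag i) (sym (diag' i)))

-- In a projective pair the r-th rows agree on the diagonal column r, hence
-- (by projectivity) in no other column.
projective-offDiagonal-≢ : ∀ {κ} {L L' : Array κ} → Projective L L' →
                           ∀ r c → r ≢ c → L r c ≢ L' r c
projective-offDiagonal-≢ {L = L} {L'} (diag , diag' , agreeOnce) r c r≢c eq =
  r≢c (exactlyOne-unique (agreeOnce r r) (unitDiagonal-agree {L = L} {L'} diag diag' r) eq)

avoiding-injection⇒≤ : ∀ {s n} (p : Fin (suc n)) (f : Fin s → Fin (suc n)) →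
                       (avoids : ∀ a → p ≢ f a) →
                       (∀ {a b} → f a ≡ f b → a ≡ b) → s ≤ n
avoiding-injection⇒≤ p f avoids inj =
  injective⇒≤ {f = λ a → punchOut (avoids a)}
              (λ eq → inj (punchOut-injective (avoids _) (avoids _) eq))

theorem27 : (κ : ℕ) → 2 ≤ κ → (s : ℕ) → (L : Fin s → Array κ) →
    ((a : Fin s) → IsLatin (L a)) →
    ((a b : Fin s) → a ≢ b → Distinct (L a) (L b)) →
    ((a b : Fin s) → a ≢ b → Projective (L a) (L b)) →
    s ≤ κ ∸ 1
theorem27 _ _ 0 _ _ _ _ = z≤n
theorem27 (suc (suc k)) (s≤s (s≤s z≤n)) 1 _ _ _ _ = s≤s z≤n
theorem27 (suc (suc k)) (s≤s (s≤s z≤n)) (suc (suc m)) L latin _ projective =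
  avoiding-injection⇒≤ zero (λ a → L a zero one) not-symbol-1 injective
  where
  one : Fin (suc (suc k))
  one = suc zero

  partner : Fin (suc (suc m)) → Fin (suc (suc m))
  partner zero    = suc zero
  partner (suc _) = zero

  partner-≢ : ∀ a → a ≢ partner a
  partner-≢ zero    ()
  partner-≢ (suc _) ()

  corner-is-1 : ∀ a → L a zero zero ≡ zero
  corner-is-1 a = toℕ-injective (proj₁ (projective a (partner a) (partner-≢ a)) zero)

  -- Row 0 already holds the symbol 1 in column 0, so not in column 1.
  not-symbol-1 : ∀ a → zero ≢ L a zero one
  not-symbol-1 a eq with latin-row-injective (latin a) zero (trans (corner-is-1 a) eq)
  ... | ()

  -- Distinct squares differ at (0,1), an off-diagonal entry of row 0.
  injective : ∀ {a b} → L a zero one ≡ L b zero one → a ≡ b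
  injective {a} {b} eq with a ≟ b
  ... | yes a≡b = a≡b
  ... | no  a≢b = ⊥-elim (projective-offDiagonal-≢ (projective a b a≢b) zero one (λ ()) eq)
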